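{- Let $G=(V,E)$ be a finite simple graph with a vertex cut $C$. Let $V_1$ be the vertex set of one of the connected components of $G-C$, let $V_2=V\setminus(V_1\cup C)$, and let $G_1=G[V_1\cup C]$ and $G_2=G[V_2\cup C]$. If there exist zero forcing sets $S_1$ of $G_1$ and $S_2$ of $G_2$ with $C\subseteq S_1\cap S_2$, then there exists a zero forcing set for $G$ of size $|S_1|+|S_2|-|C|$.
   Context: Zero forcing: vertices are blue or white; a blue vertex $u$ may force (recolour blue) a white neighbour $v$ if $v$ is the only white vertex in $N[u]$. A zero forcing set of a graph is a set of vertices such that, starting with exactly these vertices blue and repeatedly applying this rule, all vertices eventually become blue. -}

module Defs where

open import Data.Nat using (ℕ)
open import Data.Fin using (Fin)
open import Data.Fin.Subset using (Subset; _∈_; _∉_; _⊆_; _∪_; ∁)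
open import Data.Product using (_×_; ∃)
open import Relation.Binary.PropositionalEquality using (_≡_)
open import Relation.Nullary using (¬_; Dec)

record Graph (n : ℕ) : Set₁ where
  field
    Adj   : Fin n → Fin n → Set
    adj?  : ∀ u v → Dec (Adj u v)
    sym   : ∀ {u v} → Adj u v → Adj v u
    irrefl : ∀ {u} → ¬ Adj u u
open Graph public

module _ {n : ℕ} (G : Graph n) where

  -- Zero forcing in the induced subgraph G[W] (vertices in W, edges of G
  -- between them), starting with the blue set S.
  data Blue (W S : Subset n) : Fin n → Set where
    init  : ∀ {v} → v ∈ S → Blue W S v
    force : ∀ {u v} → u ∈ W → v ∈ W → Adj G u v → Blue W S u →
            (∀ w → w ∈ W → Adj G u w → ¬ (w ≡ v) → Blue W S w) →
            Blue W S v

  IsZFSetOn : Subset n → Subset n → Set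
  IsZFSetOn W S = S ⊆ W × (∀ v → v ∈ W → Blue W S v)

  IsZFSet : Subset n → Set
  IsZFSet S = ∀ v → Blue Data.Fin.Subset.⊤ S v

  data ReachAvoid (C : Subset n) : Fin n → Fin n → Set where
    here : ∀ {x} → x ∉ C → ReachAvoid C x x
    step : ∀ {x y z} → x ∉ C → Adj G x y → ReachAvoid C y z → ReachAvoid C x z

  IsVertexCut : Subset n → Set
  IsVertexCut C = ∃ λ x → ∃ λ y → x ∉ C × y ∉ C × ¬ ReachAvoid C x y

  IsComponentOf- : Subset n → Subset n → Set
  IsComponentOf- C V₁ =
    (∃ λ x → x ∈ V₁) ×
    (∀ x → x ∈ V₁ → x ∉ C) ×
    (∀ x y → x ∈ V₁ → y ∈ V₁ → ReachAvoid C x y) ×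
    (∀ x y → x ∈ V₁ → ReachAvoid C x y → y ∈ V₁)

-- Run the forcing process of S₁ in G₁ to completion and reverse the resulting
-- chronology: the terminal set T (the vertices that never force) has |T| = |S₁|
-- and forces all of G₁ along the reversed chronology.  Since C ⊆ S₁, no vertex
-- of C is ever forced, so every forcer of the reversed chronology lies in V₁,
-- whose neighbourhood in G stays inside V₁ ∪ C; hence the reversed forces are
-- forces in G as well.  Once V₁ ∪ C is blue, every force of S₂ in G₂ is a force
-- in G, so T ∪ (S₂ ∖ C) is a zero forcing set of G of the required size.
module Submission where

open import Defs
open import Data.Nat using (ℕ; zero; suc; _+_; _∸_)
open import Data.Nat.Properties using (+-suc; +-identityʳ; +-∸-assoc; m+n∸n≡m; m+[n∸m]≡n)
open import Data.Fin using (Fin; _≟_)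
open import Data.Fin.Properties using (any?; all?)
open import Data.Fin.Subset
  using (Subset; _∈_; _∉_; _⊆_; _∪_; _∩_; _─_; ∁; ⁅_⁆; ∣_∣; inside; outside)
  renaming (⊤ to ⊤ₛ; ⊥ to ∅)
open import Data.Fin.Subset.Properties
  using ( _∈?_; ∉⊥; ∈⊤; x∈⁅x⁆; x∈⁅y⁆⇒x≡y; ∣⁅x⁆∣≡1; ∣⊥∣≡0; ∣p∣≤n; ∣p∣≡n⇒p≡⊤
        ; p⊆q⇒∣p∣≤∣q∣; drop-∷-⊆; p⊆p∪q; q⊆p∪q; x∈p∪q⁻; x∈p∩q⁻; x∈∁p⇒x∉p; x∉∁p⇒x∈p
        ; p─q⊆p; x∈p∧x∉q⇒x∈p─q; ⊆⊤; ∪-assoc; ∪-comm; ∪-identityˡ; ∪-identityʳ )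
open import Data.Vec using ([]; _∷_; here; there)
open import Data.List using (List; []; _∷_; _++_; length)
open import Data.Product using (∃; _×_; _,_; proj₁; proj₂; swap)
open import Data.Sum using (_⊎_; inj₁; inj₂; [_,_]′)
open import Function using (_∘_)
open import Relation.Nullary using (Dec; yes; no; ¬?; contradiction)
open import Relation.Nullary.Decidable using (_×-dec_; _→-dec_; map′; decidable-stable)
open import Relation.Binary.PropositionalEquality
  using (_≡_; _≢_; refl; trans; cong; cong₂; subst; module ≡-Reasoning)
  renaming (sym to ≡-sym)

open ≡-Reasoning

y∈⁅x⁆∪p⁻ : ∀ {n} {x y : Fin n} {p : Subset n} → y ∈ ⁅ x ⁆ ∪ p → y ≡ x ⊎ y ∈ p
y∈⁅x⁆∪p⁻ {x = x} {p = p} y∈ with x∈p∪q⁻ ⁅ x ⁆ p y∈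
... | inj₁ y∈⁅x⁆ = inj₁ (x∈⁅y⁆⇒x≡y x y∈⁅x⁆)
... | inj₂ y∈p   = inj₂ y∈p

x∈⁅x⁆∪p : ∀ {n} (x : Fin n) {p : Subset n} → x ∈ ⁅ x ⁆ ∪ p
x∈⁅x⁆∪p x = p⊆p∪q _ (x∈⁅x⁆ x)

x∈p─q⇒x∉q : ∀ {n} {x : Fin n} (p q : Subset n) → x ∈ p ─ q → x ∉ q
x∈p─q⇒x∉q (inside ∷ p) (outside ∷ q) here       ()
x∈p─q⇒x∉q (_      ∷ p) (_       ∷ q) (there x∈) (there x∈q) = x∈p─q⇒x∉q p q x∈ x∈q

∣p∪q∣≡∣p∣+∣q∣ : ∀ {n} (p q : Subset n) → (∀ {x} → x ∈ p → x ∉ q) →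
                ∣ p ∪ q ∣ ≡ ∣ p ∣ + ∣ q ∣
∣p∪q∣≡∣p∣+∣q∣ []            []            _        = refl
∣p∪q∣≡∣p∣+∣q∣ (inside  ∷ p) (inside  ∷ q) disjoint = contradiction here (disjoint here)
∣p∪q∣≡∣p∣+∣q∣ (inside  ∷ p) (outside ∷ q) disjoint =
  cong suc (∣p∪q∣≡∣p∣+∣q∣ p q (λ x∈p → disjoint (there x∈p) ∘ there))
∣p∪q∣≡∣p∣+∣q∣ (outside ∷ p) (inside  ∷ q) disjoint =
  trans (cong suc (∣p∪q∣≡∣p∣+∣q∣ p q (λ x∈p → disjoint (there x∈p) ∘ there)))
        (≡-sym (+-suc ∣ p ∣ ∣ q ∣))
∣p∪q∣≡∣p∣+∣q∣ (outside ∷ p) (outside ∷ q) disjoint =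
  ∣p∪q∣≡∣p∣+∣q∣ p q (λ x∈p → disjoint (there x∈p) ∘ there)

∣⁅x⁆∪p∣≡1+∣p∣ : ∀ {n} {x : Fin n} {p : Subset n} → x ∉ p → ∣ ⁅ x ⁆ ∪ p ∣ ≡ suc ∣ p ∣
∣⁅x⁆∪p∣≡1+∣p∣ {x = x} {p} x∉p =
  trans (∣p∪q∣≡∣p∣+∣q∣ ⁅ x ⁆ p (λ y∈⁅x⁆ → subst (_∉ p) (≡-sym (x∈⁅y⁆⇒x≡y x y∈⁅x⁆)) x∉p))
        (cong (_+ ∣ p ∣) (∣⁅x⁆∣≡1 x))

∣p─q∣+∣q∣≡∣p∣ : ∀ {n} (p q : Subset n) → q ⊆ p → ∣ p ─ q ∣ + ∣ q ∣ ≡ ∣ p ∣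
∣p─q∣+∣q∣≡∣p∣ []            []            _   = refl
∣p─q∣+∣q∣≡∣p∣ (inside  ∷ p) (inside  ∷ q) q⊆p =
  trans (+-suc ∣ p ─ q ∣ ∣ q ∣) (cong suc (∣p─q∣+∣q∣≡∣p∣ p q (drop-∷-⊆ q⊆p)))
∣p─q∣+∣q∣≡∣p∣ (outside ∷ p) (inside  ∷ q) q⊆p = contradiction (q⊆p here) λ ()
∣p─q∣+∣q∣≡∣p∣ (inside  ∷ p) (outside ∷ q) q⊆p = cong suc (∣p─q∣+∣q∣≡∣p∣ p q (drop-∷-⊆ q⊆p))
∣p─q∣+∣q∣≡∣p∣ (outside ∷ p) (outside ∷ q) q⊆p = ∣p─q∣+∣q∣≡∣p∣ p q (drop-∷-⊆ q⊆p)

∣p─q∣≡∣p∣∸∣q∣ : ∀ {n} {p q : Subset n} → q ⊆ p → ∣ p ─ q ∣ ≡ ∣ p ∣ ∸ ∣ q ∣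
∣p─q∣≡∣p∣∸∣q∣ {p = p} {q} q⊆p = begin
  ∣ p ─ q ∣                 ≡⟨ m+n∸n≡m ∣ p ─ q ∣ ∣ q ∣ ⟨
  ∣ p ─ q ∣ + ∣ q ∣ ∸ ∣ q ∣ ≡⟨ cong (_∸ ∣ q ∣) (∣p─q∣+∣q∣≡∣p∣ p q q⊆p) ⟩
  ∣ p ∣ ∸ ∣ q ∣             ∎

∣p∪[q─r]∣≡∣p∣+∣q∣∸∣r∣ : ∀ {n} (p q r : Subset n) → r ⊆ q → (∀ {x} → x ∈ p → x ∈ q → x ∈ r) →
                        ∣ p ∪ (q ─ r) ∣ ≡ ∣ p ∣ + ∣ q ∣ ∸ ∣ r ∣
∣p∪[q─r]∣≡∣p∣+∣q∣∸∣r∣ p q r r⊆q p∩q⊆r = begin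
  ∣ p ∪ (q ─ r) ∣         ≡⟨ ∣p∪q∣≡∣p∣+∣q∣ p (q ─ r) disjoint ⟩
  ∣ p ∣ + ∣ q ─ r ∣       ≡⟨ cong (∣ p ∣ +_) (∣p─q∣≡∣p∣∸∣q∣ r⊆q) ⟩
  ∣ p ∣ + (∣ q ∣ ∸ ∣ r ∣) ≡⟨ +-∸-assoc ∣ p ∣ (p⊆q⇒∣p∣≤∣q∣ r⊆q) ⟨
  ∣ p ∣ + ∣ q ∣ ∸ ∣ r ∣   ∎
  where
  disjoint : ∀ {x} → x ∈ p → x ∉ q ─ r
  disjoint x∈p x∈q─r = x∈p─q⇒x∉q q r x∈q─r (p∩q⊆r x∈p (p─q⊆p q r x∈q─r))

-- Chronologies of forces

Force : ℕ → Set
Force n = Fin n × Fin n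

module _ {n : ℕ} where

  endpoints : (Force n → Fin n) → List (Force n) → Subset n
  endpoints f []      = ∅
  endpoints f (e ∷ M) = ⁅ f e ⁆ ∪ endpoints f M

  forcers targets : List (Force n) → Subset n
  forcers = endpoints proj₁
  targets = endpoints proj₂

  reversal : List (Force n) → List (Force n)
  reversal []      = []
  reversal (e ∷ M) = reversal M ++ (swap e ∷ [])

  after : Subset n → List (Force n) → Subset n
  after B []            = B
  after B ((u , v) ∷ M) = after (⁅ v ⁆ ∪ B) M

  endpoints-++ : ∀ f P Q → endpoints f (P ++ Q) ≡ endpoints f P ∪ endpoints f Q
  endpoints-++ f []      Q = ≡-sym (∪-identityˡ (endpoints f Q))
  endpoints-++ f (e ∷ P) Q =
    trans (cong (⁅ f e ⁆ ∪_) (endpoints-++ f P Q)) (≡-sym (∪-assoc ⁅ f e ⁆ _ _))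

  endpoints-reversal : ∀ f M → endpoints f (reversal M) ≡ endpoints (f ∘ swap) M
  endpoints-reversal f []      = refl
  endpoints-reversal f (e ∷ M) = begin
    endpoints f (reversal M ++ (swap e ∷ []))          ≡⟨ endpoints-++ f (reversal M) _ ⟩
    endpoints f (reversal M) ∪ (⁅ f (swap e) ⁆ ∪ ∅)    ≡⟨ cong₂ _∪_ (endpoints-reversal f M) (∪-identityʳ _) ⟩
    endpoints (f ∘ swap) M ∪ ⁅ f (swap e) ⁆            ≡⟨ ∪-comm _ _ ⟩
    ⁅ f (swap e) ⁆ ∪ endpoints (f ∘ swap) M            ∎

  ⊆-after : ∀ B M → B ⊆ after B M
  ⊆-after B []            = λ x∈B → x∈B
  ⊆-after B ((u , v) ∷ M) = ⊆-after (⁅ v ⁆ ∪ B) M ∘ q⊆p∪q ⁅ v ⁆ B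

  targets⊆after : ∀ B M → targets M ⊆ after B M
  targets⊆after B []            x∈ = contradiction x∈ ∉⊥
  targets⊆after B ((u , v) ∷ M) x∈ with y∈⁅x⁆∪p⁻ x∈
  ... | inj₁ refl  = ⊆-after (⁅ v ⁆ ∪ B) M (x∈⁅x⁆∪p v)
  ... | inj₂ x∈Tg = targets⊆after (⁅ v ⁆ ∪ B) M x∈Tg

  -- Every forcer of M is a target of its reversal, hence blue at the end.
  ∈-after-reversal : ∀ M {T x} → (x ∉ forcers M → x ∈ T) → x ∈ after T (reversal M)
  ∈-after-reversal M {T} {x} x∈T with x ∈? forcers M
  ... | yes x∈F = targets⊆after T (reversal M) (subst (x ∈_) (≡-sym (endpoints-reversal proj₂ M)) x∈F)
  ... | no  x∉F = ⊆-after T (reversal M) (x∈T x∉F)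

-- Forcing in an induced subgraph G[W]

module _ {n : ℕ} (G : Graph n) where

  record CanForce (W B : Subset n) (u v : Fin n) : Set where
    field
      forcer-blue : u ∈ B
      forcer∈W    : u ∈ W
      target∈W    : v ∈ W
      adjacent    : Adj G u v
      others-blue : ∀ {w} → w ∈ W → Adj G u w → w ≢ v → w ∈ B
  open CanForce

  canForce? : ∀ W B u v → Dec (CanForce W B u v)
  canForce? W B u v =
    map′ (λ (uB , uW , vW , uv , others) → record
           { forcer-blue = uB ; forcer∈W = uW ; target∈W = vW ; adjacent = uv
           ; others-blue = λ {w} → others w })
         (λ cf → forcer-blue cf , forcer∈W cf , target∈W cf , adjacent cf , λ w → others-blue cf)
         (u ∈? B ×-dec u ∈? W ×-dec v ∈? W ×-dec adj? G u v ×-dec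
          all? (λ w → w ∈? W →-dec adj? G u w →-dec ¬? (w ≟ v) →-dec w ∈? B))

  canForce⇒saturated : ∀ {W B u v} → CanForce W B u v →
                       ∀ {w} → w ∈ W → Adj G u w → w ∈ ⁅ v ⁆ ∪ B
  canForce⇒saturated {v = v} cf {w} w∈W uw with w ≟ v
  ... | yes refl = x∈⁅x⁆∪p v
  ... | no  w≢v  = q⊆p∪q _ _ (others-blue cf w∈W uw w≢v)

  canForce⇒blue : ∀ {W S B u v} → CanForce W B u v →
                  (∀ {w} → w ∈ B → Blue G W S w) → Blue G W S v
  canForce⇒blue cf blue =
    force (forcer∈W cf) (target∈W cf) (adjacent cf) (blue (forcer-blue cf))
          (λ w w∈W uw w≢v → blue (others-blue cf w∈W uw w≢v))

  canForce-local : ∀ {W B B′ u v} →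
                   (∀ {w} → w ∈ W → w ≡ u ⊎ Adj G u w → w ∈ B → w ∈ B′) →
                   CanForce W B u v → CanForce W B′ u v
  canForce-local local cf = record
    { forcer-blue = local (forcer∈W cf) (inj₁ refl) (forcer-blue cf)
    ; forcer∈W    = forcer∈W cf
    ; target∈W    = target∈W cf
    ; adjacent    = adjacent cf
    ; others-blue = λ w∈W uw w≢v → local w∈W (inj₂ uw) (others-blue cf w∈W uw w≢v) }

  canForce-widen : ∀ {W W′ B u v} → W ⊆ W′ → (∀ {w} → Adj G u w → w ∈ W) →
                   CanForce W B u v → CanForce W′ B u v
  canForce-widen W⊆W′ N[u]⊆W cf = record
    { forcer-blue = forcer-blue cf
    ; forcer∈W    = W⊆W′ (forcer∈W cf)
    ; target∈W    = W⊆W′ (target∈W cf)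
    ; adjacent    = adjacent cf
    ; others-blue = λ _ uw → others-blue cf (N[u]⊆W uw) uw }

  -- A valid chronology may force vertices that are already blue; a proper one
  -- may not.  Reversing a proper chronology only yields a valid one.
  data Valid (W : Subset n) : Subset n → List (Force n) → Set where
    []  : ∀ {B} → Valid W B []
    _∷_ : ∀ {B u v M} → CanForce W B u v → Valid W (⁅ v ⁆ ∪ B) M → Valid W B ((u , v) ∷ M)

  data Proper (W : Subset n) : Subset n → List (Force n) → Set where
    []    : ∀ {B} → Proper W B []
    force : ∀ {B u v M} → CanForce W B u v → v ∉ B → Proper W (⁅ v ⁆ ∪ B) M →
            Proper W B ((u , v) ∷ M)

  Stalled : Subset n → Subset n → Set
  Stalled W B = ∀ {u v} → CanForce W B u v → v ∈ B

  proper⇒valid : ∀ {W B M} → Proper W B M → Valid W B M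
  proper⇒valid []                  = []
  proper⇒valid (force cf _ proper) = cf ∷ proper⇒valid proper

  module _ {W : Subset n} where

    valid-++ : ∀ {B P Q} → Valid W B P → Valid W (after B P) Q → Valid W B (P ++ Q)
    valid-++ []             valid-Q = valid-Q
    valid-++ (cf ∷ valid-P) valid-Q = cf ∷ valid-++ valid-P valid-Q

    valid-local : ∀ {B B′ M} →
                  (∀ {a w} → a ∈ forcers M → w ∈ W → w ≡ a ⊎ Adj G a w → w ∈ B → w ∈ B′) →
                  Valid W B M → Valid W B′ M
    valid-local local []                        = []
    valid-local {B} {B′} local (_∷_ {u = u} {v} {M} cf valid) =
      canForce-local (local (x∈⁅x⁆∪p u)) cf ∷ valid-local local′ valid
      where
      local′ : ∀ {a w} → a ∈ forcers M → w ∈ W → w ≡ a ⊎ Adj G a w →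
               w ∈ ⁅ v ⁆ ∪ B → w ∈ ⁅ v ⁆ ∪ B′
      local′ a∈ w∈W near w∈ with y∈⁅x⁆∪p⁻ w∈
      ... | inj₁ refl = x∈⁅x⁆∪p v
      ... | inj₂ w∈B  = q⊆p∪q _ _ (local (q⊆p∪q _ _ a∈) w∈W near w∈B)

    valid-widen : ∀ {W′ B M} → W ⊆ W′ → (∀ {a w} → a ∈ forcers M → Adj G a w → w ∈ W) →
                  Valid W B M → Valid W′ B M
    valid-widen W⊆W′ N⊆W []           = []
    valid-widen W⊆W′ N⊆W (cf ∷ valid) =
      canForce-widen W⊆W′ (N⊆W (x∈⁅x⁆∪p _)) cf ∷ valid-widen W⊆W′ (N⊆W ∘ q⊆p∪q _ _) valid

    valid⇒blue : ∀ {S B M} → Valid W B M → (∀ {w} → w ∈ B → Blue G W S w) →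
                 ∀ {w} → w ∈ after B M → Blue G W S w
    valid⇒blue []           blue = blue
    valid⇒blue {S} {B} (_∷_ {v = v} cf valid) blue = valid⇒blue valid blue′
      where
      blue′ : ∀ {w} → w ∈ ⁅ v ⁆ ∪ B → Blue G W S w
      blue′ w∈ with y∈⁅x⁆∪p⁻ w∈
      ... | inj₁ refl = canForce⇒blue cf blue
      ... | inj₂ w∈B  = blue w∈B

    forcers⊆W : ∀ {B M} → Valid W B M → forcers M ⊆ W
    forcers⊆W []           x∈ = contradiction x∈ ∉⊥
    forcers⊆W (cf ∷ valid) x∈ with y∈⁅x⁆∪p⁻ x∈
    ... | inj₁ refl = forcer∈W cf
    ... | inj₂ x∈F  = forcers⊆W valid x∈F

    targets⊆W : ∀ {B M} → Valid W B M → targets M ⊆ W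
    targets⊆W []           x∈ = contradiction x∈ ∉⊥
    targets⊆W (cf ∷ valid) x∈ with y∈⁅x⁆∪p⁻ x∈
    ... | inj₁ refl = target∈W cf
    ... | inj₂ x∈Tg = targets⊆W valid x∈Tg

    after⊆W : ∀ {B M} → B ⊆ W → Valid W B M → after B M ⊆ W
    after⊆W B⊆W []           = B⊆W
    after⊆W {B} B⊆W (_∷_ {v = v} cf valid) = after⊆W ⁅v⁆∪B⊆W valid
      where
      ⁅v⁆∪B⊆W : ⁅ v ⁆ ∪ B ⊆ W
      ⁅v⁆∪B⊆W x∈ with y∈⁅x⁆∪p⁻ x∈
      ... | inj₁ refl = target∈W cf
      ... | inj₂ x∈B  = B⊆W x∈B

    stalled-blue : ∀ {S B} → S ⊆ B → Stalled W B → ∀ {v} → Blue G W S v → v ∈ B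
    stalled-blue S⊆B stalled (init v∈S) = S⊆B v∈S
    stalled-blue S⊆B stalled (force u∈W v∈W uv blue-u others) = stalled record
      { forcer-blue = stalled-blue S⊆B stalled blue-u
      ; forcer∈W    = u∈W
      ; target∈W    = v∈W
      ; adjacent    = uv
      ; others-blue = λ w∈W uw w≢v → stalled-blue S⊆B stalled (others _ w∈W uw w≢v) }

    maximal-chronology : ∀ B → ∃ λ M → Proper W B M × Stalled W (after B M)
    maximal-chronology B₀ = grow (n ∸ ∣ B₀ ∣) B₀ (m+[n∸m]≡n (∣p∣≤n B₀))
      where
      grow : ∀ k B → ∣ B ∣ + k ≡ n → ∃ λ M → Proper W B M × Stalled W (after B M)
      grow zero    B ∣B∣≡n = [] , [] , λ {_} {v} _ →
        subst (v ∈_) (≡-sym (∣p∣≡n⇒p≡⊤ (trans (≡-sym (+-identityʳ ∣ B ∣)) ∣B∣≡n))) ∈⊤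
      grow (suc k) B ∣B∣+k≡n
        with any? (λ u → any? (λ v → canForce? W B u v ×-dec ¬? (v ∈? B)))
      ... | no stuck = [] , [] , λ {u} {v} cf →
        decidable-stable (v ∈? B) (λ v∉B → stuck (u , v , cf , v∉B))
      ... | yes (u , v , cf , v∉B) =
        let M , proper , stalled = grow k (⁅ v ⁆ ∪ B)
              (trans (cong (_+ k) (∣⁅x⁆∪p∣≡1+∣p∣ v∉B)) (trans (≡-sym (+-suc ∣ B ∣ k)) ∣B∣+k≡n))
        in (u , v) ∷ M , force cf v∉B proper , stalled

    ∣after∣≡∣B∣+length : ∀ {B M} → Proper W B M → ∣ after B M ∣ ≡ ∣ B ∣ + length M
    ∣after∣≡∣B∣+length {B} []                                   = ≡-sym (+-identityʳ ∣ B ∣)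
    ∣after∣≡∣B∣+length {B} (force {v = v} {M = M} _ v∉B proper) = begin
      ∣ after (⁅ v ⁆ ∪ B) M ∣ ≡⟨ ∣after∣≡∣B∣+length proper ⟩
      ∣ ⁅ v ⁆ ∪ B ∣ + length M ≡⟨ cong (_+ length M) (∣⁅x⁆∪p∣≡1+∣p∣ v∉B) ⟩
      suc ∣ B ∣ + length M    ≡⟨ +-suc ∣ B ∣ (length M) ⟨
      ∣ B ∣ + suc (length M)  ∎

    targets-white : ∀ {B M} → Proper W B M → ∀ {t} → t ∈ targets M → t ∉ B
    targets-white []                  t∈ = contradiction t∈ ∉⊥
    targets-white (force _ v∉B proper) t∈ t∈B with y∈⁅x⁆∪p⁻ t∈
    ... | inj₁ refl = v∉B t∈B
    ... | inj₂ t∈Tg = targets-white proper t∈Tg (q⊆p∪q _ _ t∈B)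

    saturated⇒∉forcers : ∀ {B M u} → Proper W B M → u ∈ B →
                         (∀ {w} → w ∈ W → Adj G u w → w ∈ B) → u ∉ forcers M
    saturated⇒∉forcers []                   _   _         u∈ = ∉⊥ u∈
    saturated⇒∉forcers (force cf v∉B proper) u∈B saturated u∈ with y∈⁅x⁆∪p⁻ u∈
    ... | inj₁ refl = v∉B (saturated (target∈W cf) (adjacent cf))
    ... | inj₂ u∈F  = saturated⇒∉forcers proper (q⊆p∪q _ _ u∈B)
                        (λ w∈W uw → q⊆p∪q _ _ (saturated w∈W uw)) u∈F

    ∣forcers∣≡length : ∀ {B M} → Proper W B M → ∣ forcers M ∣ ≡ length M
    ∣forcers∣≡length []                    = ∣⊥∣≡0 n
    ∣forcers∣≡length (force cf v∉B proper) =
      trans (∣⁅x⁆∪p∣≡1+∣p∣ (saturated⇒∉forcers proper (q⊆p∪q _ _ (forcer-blue cf))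
                                                  (canForce⇒saturated cf)))
            (cong suc (∣forcers∣≡length proper))

    reversal-valid : ∀ {B M} → Proper W B M → W ⊆ after B M →
                     Valid W (after B M ─ forcers M) (reversal M)
    reversal-valid [] _ = []
    reversal-valid {B} (force {u = u} {v} {M} cf v∉B proper) W⊆F =
      valid-++ (valid-local unaffected (reversal-valid proper W⊆F)) (last ∷ [])
      where
      F = after (⁅ v ⁆ ∪ B) M
      T = F ─ (⁅ u ⁆ ∪ forcers M)

      ∈T : ∀ {w} → w ∈ F → w ≢ u → w ∉ forcers M → w ∈ T
      ∈T w∈F w≢u w∉F = x∈p∧x∉q⇒x∈p─q w∈F (λ w∈ → [ w≢u , w∉F ]′ (y∈⁅x⁆∪p⁻ w∈))

      -- Forcers of the reversed tail are targets of M: white when u forces v,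
      -- so neither equal nor adjacent to u.
      unaffected : ∀ {a w} → a ∈ forcers (reversal M) → w ∈ W → w ≡ a ⊎ Adj G a w →
                   w ∈ F ─ forcers M → w ∈ T
      unaffected {a} a∈ w∈W near w∈ =
        ∈T (p─q⊆p F (forcers M) w∈) (w≢u near) (x∈p─q⇒x∉q F (forcers M) w∈)
        where
        a∈Tg : a ∈ targets M
        a∈Tg = subst (a ∈_) (endpoints-reversal proj₁ M) a∈
        a-white : a ∉ ⁅ v ⁆ ∪ B
        a-white = targets-white proper a∈Tg
        w≢u : ∀ {w} → w ≡ a ⊎ Adj G a w → w ≢ u
        w≢u (inj₁ refl) refl = a-white (q⊆p∪q _ _ (forcer-blue cf))
        w≢u (inj₂ aw)   refl =
          a-white (canForce⇒saturated cf (targets⊆W (proper⇒valid proper) a∈Tg) (sym G aw))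

      blue-unless-u : ∀ {w} → w ∈ F → w ≢ u → w ∈ after T (reversal M)
      blue-unless-u w∈F w≢u = ∈-after-reversal M (∈T w∈F w≢u)

      last : CanForce W (after T (reversal M)) v u
      last = record
        { forcer-blue = blue-unless-u (⊆-after _ M (x∈⁅x⁆∪p v)) (λ { refl → irrefl G (adjacent cf) })
        ; forcer∈W    = target∈W cf
        ; target∈W    = forcer∈W cf
        ; adjacent    = sym G (adjacent cf)
        ; others-blue = λ w∈W _ → blue-unless-u (W⊆F w∈W) }

  record Reversal (W S : Subset n) : Set where
    field
      terminal    : Subset n
      chronology  : List (Force n)
      terminal⊆W  : terminal ⊆ W
      ∣terminal∣  : ∣ terminal ∣ ≡ ∣ S ∣
      valid       : Valid W terminal chronology
      complete    : W ⊆ after terminal chronology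
      forcers⊆W─S : forcers chronology ⊆ W ─ S

  zfSetOn⇒reversal : ∀ {W S} → IsZFSetOn G W S → Reversal W S
  zfSetOn⇒reversal {W} {S} (S⊆W , S-forces-W) with maximal-chronology {W} S
  ... | M , proper , stalled = record
    { terminal    = F ─ forcers M
    ; chronology  = reversal M
    ; terminal⊆W  = F⊆W ∘ p─q⊆p F (forcers M)
    ; ∣terminal∣  = begin
        ∣ F ─ forcers M ∣               ≡⟨ ∣p─q∣≡∣p∣∸∣q∣ (W⊆F ∘ forcers⊆W valid) ⟩
        ∣ F ∣ ∸ ∣ forcers M ∣           ≡⟨ cong₂ _∸_ (∣after∣≡∣B∣+length proper) (∣forcers∣≡length proper) ⟩
        ∣ S ∣ + length M ∸ length M     ≡⟨ m+n∸n≡m ∣ S ∣ (length M) ⟩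
        ∣ S ∣                           ∎
    ; valid       = reversal-valid proper W⊆F
    ; complete    = λ w∈W → ∈-after-reversal M (x∈p∧x∉q⇒x∈p─q (W⊆F w∈W))
    ; forcers⊆W─S = λ {a} a∈ →
        let a∈Tg = subst (a ∈_) (endpoints-reversal proj₁ M) a∈
        in x∈p∧x∉q⇒x∈p─q (targets⊆W valid a∈Tg) (targets-white proper a∈Tg)
    }
    where
    F = after S M
    valid = proper⇒valid proper
    W⊆F : W ⊆ F
    W⊆F w∈W = stalled-blue (⊆-after S M) stalled (S-forces-W _ w∈W)
    F⊆W : F ⊆ W
    F⊆W = after⊆W S⊆W valid

  blue-widen : ∀ {W W′ S S′} → W ⊆ W′ →
               (∀ {w} → w ∈ S → Blue G W′ S′ w) → (∀ {w} → w ∈ W′ → w ∉ W → Blue G W′ S′ w) →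
               ∀ {v} → Blue G W S v → Blue G W′ S′ v
  blue-widen W⊆W′ S-blue outside-blue (init v∈S) = S-blue v∈S
  blue-widen {W} {W′} {S} {S′} W⊆W′ S-blue outside-blue
             (force {u} {v} u∈W v∈W uv blue-u others) =
    force (W⊆W′ u∈W) (W⊆W′ v∈W) uv (blue-widen W⊆W′ S-blue outside-blue blue-u) others′
    where
    others′ : ∀ w → w ∈ W′ → Adj G u w → w ≢ v → Blue G W′ S′ w
    others′ w w∈W′ uw w≢v with w ∈? W
    ... | yes w∈W = blue-widen W⊆W′ S-blue outside-blue (others w w∈W uw w≢v)
    ... | no  w∉W = outside-blue w∈W′ w∉W

  zfSetOn⇒zfSet : ∀ {W S S′} → IsZFSetOn G W S →
                  (∀ {w} → w ∈ S → Blue G ⊤ₛ S′ w) → (∀ {w} → w ∉ W → Blue G ⊤ₛ S′ w) →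
                  IsZFSet G S′
  zfSetOn⇒zfSet {W} (_ , S-forces-W) S-blue outside-blue v with v ∈? W
  ... | yes v∈W = blue-widen ⊆⊤ S-blue (λ _ → outside-blue) (S-forces-W v v∈W)
  ... | no  v∉W = outside-blue v∉W

  component-neighbour : ∀ {C V₁ a w} → IsComponentOf- G C V₁ → a ∈ V₁ → Adj G a w → w ∈ V₁ ∪ C
  component-neighbour {C} {V₁} {w = w} (_ , V₁∩C≡∅ , _ , closed) a∈V₁ aw with w ∈? C
  ... | yes w∈C = q⊆p∪q V₁ C w∈C
  ... | no  w∉C = p⊆p∪q C (closed _ _ a∈V₁ (step (V₁∩C≡∅ _ a∈V₁) aw (here w∉C)))

  -- As C ⊆ S, the reversed forces all start in V₁, so they are forces in G.
  reversal⇒blue-in-G : ∀ {C V₁ S S′} → IsComponentOf- G C V₁ → C ⊆ S →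
                        (R : Reversal (V₁ ∪ C) S) → Reversal.terminal R ⊆ S′ →
                        ∀ {w} → w ∈ V₁ ∪ C → Blue G ⊤ₛ S′ w
  reversal⇒blue-in-G {C} {V₁} {S} component C⊆S R terminal⊆S′ =
    valid⇒blue (valid-widen ⊆⊤ (component-neighbour component ∘ forcer∈V₁) valid)
               (init ∘ terminal⊆S′) ∘ complete
    where
    open Reversal R
    forcer∈V₁ : ∀ {a} → a ∈ forcers chronology → a ∈ V₁
    forcer∈V₁ a∈ with x∈p∪q⁻ V₁ C (p─q⊆p _ S (forcers⊆W─S a∈))
    ... | inj₁ a∈V₁ = a∈V₁
    ... | inj₂ a∈C  = contradiction (C⊆S a∈C) (x∈p─q⇒x∉q _ S (forcers⊆W─S a∈))

corollary3p6 : ∀ {n : ℕ} (G : Graph n) (C V₁ : Subset n) →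
    IsVertexCut G C →
    IsComponentOf- G C V₁ →
    (S₁ S₂ : Subset n) →
    IsZFSetOn G (V₁ ∪ C) S₁ →
    IsZFSetOn G (∁ (V₁ ∪ C) ∪ C) S₂ →
    C ⊆ S₁ ∩ S₂ →
    ∃ λ (S : Subset n) → IsZFSet G S × ∣ S ∣ ≡ ∣ S₁ ∣ + ∣ S₂ ∣ ∸ ∣ C ∣
corollary3p6 G C V₁ _ component S₁ S₂ zf₁ zf₂@(S₂⊆W₂ , _) C⊆S₁∩S₂ =
  S , zfSetOn⇒zfSet G zf₂ S₂-blue outside-W₂-blue , ∣S∣
  where
  R = zfSetOn⇒reversal G zf₁
  open Reversal R
  S = terminal ∪ (S₂ ─ C)

  W₁-blue : ∀ {w} → w ∈ V₁ ∪ C → Blue G ⊤ₛ S w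
  W₁-blue = reversal⇒blue-in-G G component (proj₁ ∘ x∈p∩q⁻ S₁ S₂ ∘ C⊆S₁∩S₂) R (p⊆p∪q _)

  outside-W₂-blue : ∀ {w} → w ∉ ∁ (V₁ ∪ C) ∪ C → Blue G ⊤ₛ S w
  outside-W₂-blue w∉W₂ = W₁-blue (x∉∁p⇒x∈p (w∉W₂ ∘ p⊆p∪q C))

  S₂-blue : ∀ {w} → w ∈ S₂ → Blue G ⊤ₛ S w
  S₂-blue {w} w∈S₂ with w ∈? C
  ... | yes w∈C = W₁-blue (q⊆p∪q V₁ C w∈C)
  ... | no  w∉C = init (q⊆p∪q _ _ (x∈p∧x∉q⇒x∈p─q w∈S₂ w∉C))

  terminal∩S₂⊆C : ∀ {x} → x ∈ terminal → x ∈ S₂ → x ∈ C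
  terminal∩S₂⊆C x∈T x∈S₂ with x∈p∪q⁻ _ C (S₂⊆W₂ x∈S₂)
  ... | inj₁ x∈∁W₁ = contradiction (terminal⊆W x∈T) (x∈∁p⇒x∉p x∈∁W₁)
  ... | inj₂ x∈C   = x∈C

  ∣S∣ : ∣ S ∣ ≡ ∣ S₁ ∣ + ∣ S₂ ∣ ∸ ∣ C ∣
  ∣S∣ = trans (∣p∪[q─r]∣≡∣p∣+∣q∣∸∣r∣ terminal S₂ C (proj₂ ∘ x∈p∩q⁻ S₁ S₂ ∘ C⊆S₁∩S₂) terminal∩S₂⊆C)
              (cong (λ t → t + ∣ S₂ ∣ ∸ ∣ C ∣) ∣terminal∣)
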